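{- Let $C$ be a finite category with objects $x_1,\dots,x_k$, and let $A_C$ be its adjacency matrix. Then the zeta series of $C$ is rational; namely $$Z_C(s)=\frac{\mathrm{sum}\{\mathrm{adj}(I-A_Cs)\}}{\det(I-A_Cs)},$$ where $\mathrm{adj}$ denotes the adjugate matrix and $\mathrm{sum}$ denotes the sum of all entries of a matrix.
   Context: The adjacency matrix $A_C$ is the $k\times k$ matrix whose $(i,j)$-entry is the number of morphisms from $x_i$ to $x_j$. For $i\ge 0$, $N_i(C)$ is the set of chains $y_0\to y_1\to\cdots\to y_i$ of $i$ composable morphisms in $C$ (identity morphisms allowed; $N_0(C)$ is the set of objects). The zeta series of $C$ is $Z_C(s)=\sum_{i=0}^\infty\#N_i(C)s^i$, $s$ a complex variable. -}

module Defs where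

open import Data.Nat as ℕ using (ℕ; zero; suc)
open import Data.Integer as ℤ using (ℤ; +_)
open import Data.Fin as Fin using (Fin; zero; suc; toℕ; punchIn; _≟_)
open import Data.Product using (Σ; _,_)
open import Relation.Binary.PropositionalEquality using (_≡_)
open import Relation.Nullary using (yes; no)

-- Finite categories.  Objects are x_0,…,x_{k-1} (= Fin k); the hom-set
-- from x to y is the finite set Fin (hom x y), so hom x y = #Hom(x,y).

record FinCat : Set where
  field
    k    : ℕ
    hom  : Fin k → Fin k → ℕ
  Hom : Fin k → Fin k → Set
  Hom x y = Fin (hom x y)
  field
    idm  : (x : Fin k) → Hom x x
    comp : {x y z : Fin k} → Hom y z → Hom x y → Hom x z
    idˡ  : {x y : Fin k} (f : Hom x y) → comp (idm y) f ≡ f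
    idʳ  : {x y : Fin k} (f : Hom x y) → comp f (idm x) ≡ f
    assoc : {w x y z : Fin k} (h : Hom y z) (g : Hom x y) (f : Hom w x) →
            comp (comp h g) f ≡ comp h (comp g f)

module _ (C : FinCat) where
  open FinCat C

  adjacency : Fin k → Fin k → ℕ
  adjacency = hom

  -- Chain i y : chains y_0 → y_1 → ⋯ → y_i of i composable morphisms
  -- (identities allowed) ending at y_i = y.
  data Chain : ℕ → Fin k → Set where
    start : (x : Fin k) → Chain 0 x
    step  : {i : ℕ} {y z : Fin k} → Chain i y → Hom y z → Chain (suc i) z

  N : ℕ → Set
  N i = Σ (Fin k) (Chain i)

-- Formal power series over ℤ in the variable s (coefficient functions).

Series : Set
Series = ℕ → ℤ

sumTo : ℕ → (ℕ → ℤ) → ℤ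
sumTo zero    f = f 0
sumTo (suc n) f = sumTo n f ℤ.+ f (suc n)

0ₛ 1ₛ : Series
0ₛ _ = + 0
1ₛ zero    = + 1
1ₛ (suc _) = + 0

_+ₛ_ : Series → Series → Series
(f +ₛ g) n = f n ℤ.+ g n

-ₛ_ : Series → Series
(-ₛ f) n = ℤ.- f n

_*ₛ_ : Series → Series → Series
(f *ₛ g) n = sumTo n (λ j → f j ℤ.* g (n ℕ.∸ j))

fromCoeffs : (ℕ → ℕ) → Series
fromCoeffs c n = + c n

sumFin : (n : ℕ) → (Fin n → Series) → Series
sumFin zero    f = 0ₛ
sumFin (suc n) f = f zero +ₛ sumFin n (λ j → f (suc j))

signₛ : ℕ → Series → Series
signₛ zero          f = f
signₛ (suc zero)    f = -ₛ f
signₛ (suc (suc m)) f = signₛ m f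

Matrix : ℕ → Set
Matrix n = Fin n → Fin n → Series

minor : {n : ℕ} → Matrix (suc n) → Fin (suc n) → Fin (suc n) → Matrix n
minor M i j a b = M (punchIn i a) (punchIn j b)

det : (n : ℕ) → Matrix n → Series
det zero    M = 1ₛ
det (suc n) M = sumFin (suc n) (λ j → signₛ (toℕ j) (M zero j *ₛ det n (minor M zero j)))

adj : (n : ℕ) → Matrix n → Matrix n
adj zero    M ()
adj (suc n) M i j = signₛ (toℕ i ℕ.+ toℕ j) (det n (minor M j i))

sumEntries : (n : ℕ) → Matrix n → Series
sumEntries n M = sumFin n (λ i → sumFin n (λ j → M i j))

I-As : (n : ℕ) → (Fin n → Fin n → ℕ) → Matrix n
I-As n A i j zero with i ≟ j
... | yes _ = + 1
... | no  _ = + 0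
I-As n A i j (suc zero) = ℤ.- (+ A i j)
I-As n A i j (suc (suc _)) = + 0

module Submission where

-- Let e_y be the generating series of the chains ending at the object y.  Splitting off the
-- last morphism of a chain gives e_z = 1 + s Σ_y e_y A_yz, i.e. the row vector e satisfies
-- e (I − A s) = (1, …, 1).  Multiplying on the right by adj (I − A s) and using
-- M adj(M) = det(M) I gives (Σ_y e_y) det (I − A s) = sum adj (I − A s), and Σ_y e_y = Z_C.
-- Only the sizes of the hom-sets enter.
--
-- The determinant is defined by expansion along the first row, so its properties are derived
-- over an arbitrary commutative ring: exchanging the first two rows negates it (the terms of
-- its expansion along these two rows match up in pairs with opposite signs), hence it can be
-- expanded along any row, and it vanishes on a matrix with two equal rows provided 2x = 0
-- forces x = 0, as in ℤ[[s]].

open import Algebra.Bundles using (Ring; CommutativeRing)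
open import Data.Empty using (⊥-elim)
open import Data.Fin using (Fin; zero; suc; toℕ; punchIn; lift; _≟_)
open import Data.Fin.Permutation using (↔⇒≡)
open import Data.Fin.Properties using (punchInᵢ≢i; +↔⊎; *↔×)
open import Data.Nat as ℕ using (ℕ; zero; suc)
import Data.Nat.Properties as ℕP
open import Data.Product using (Σ; _×_; _,_; proj₁; proj₂; uncurry)
import Data.Product as Product
open import Data.Product.Function.NonDependent.Propositional using (_×-↔_)
open import Data.Sum using (_⊎_; inj₁; inj₂)
open import Data.Sum.Function.Propositional using (_⊎-↔_)
open import Function using (_∘_)
open import Function.Bundles using (_↔_; mk↔ₛ′)
open import Function.Construct.Composition using (_↔-∘_)
open import Function.Construct.Identity using (↔-id)
open import Function.Construct.Symmetry using (↔-sym)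
open import Level using (_⊔_)
open import Relation.Binary.PropositionalEquality as ≡ using (_≡_; _≢_)
open import Relation.Nullary using (yes; no)

-- Finite sums and determinants over a commutative ring

module RingSum {c ℓ} (R : Ring c ℓ) where

  open Ring R hiding (zero)
  open import Algebra.Properties.Ring R using (-0#≈0#; -‿+-comm)
  open import Algebra.Properties.Semiring.Sum semiring public

  sum-zero : ∀ {n} {f : Fin n → Carrier} → (∀ i → f i ≈ 0#) → sum f ≈ 0#
  sum-zero {n} f≈0 = trans (sum-cong-≋ f≈0) (sum-replicate-zero n)

  sum-neg : ∀ {n} (f : Fin n → Carrier) → sum (λ i → - f i) ≈ - sum f
  sum-neg {zero}  f = sym -0#≈0#
  sum-neg {suc n} f = trans (+-congˡ (sum-neg (f ∘ suc))) (-‿+-comm (f zero) (sum (f ∘ suc)))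

  sum-single : ∀ {n} (f : Fin n → Carrier) j → (∀ i → i ≢ j → f i ≈ 0#) → sum f ≈ f j
  sum-single {suc n} f j vanish =
    trans (sum-remove {i = j} f)
          (trans (+-congˡ (sum-zero (λ i → vanish (punchIn j i) (punchInᵢ≢i j i)))) (+-identityʳ (f j)))

module Determinant {c ℓ} (R : CommutativeRing c ℓ) where

  open CommutativeRing R hiding (zero)
  open import Algebra.Properties.Ring ring
    using (-‿distribˡ-*; -‿distribʳ-*; -‿involutive; -‿injective; -0#≈0#; -1*x≈-x)
  open import Algebra.Properties.CommutativeSemigroup *-commutativeSemigroup
    using (x∙yz≈y∙xz; xy∙z≈y∙xz; interchange)
  open import Algebra.Properties.CommutativeSemigroup +-commutativeSemigroup
    using () renaming (x∙yz≈y∙xz to x+yz≈y+xz)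
  open RingSum ring public
  open import Relation.Binary.Reasoning.Setoid setoid

  signed : ℕ → Carrier → Carrier
  signed zero          x = x
  signed (suc zero)    x = - x
  signed (suc (suc m)) x = signed m x

  sign : ℕ → Carrier
  sign m = signed m 1#

  signed-cong : ∀ m {x y} → x ≈ y → signed m x ≈ signed m y
  signed-cong zero          x≈y = x≈y
  signed-cong (suc zero)    x≈y = -‿cong x≈y
  signed-cong (suc (suc m)) x≈y = signed-cong m x≈y

  signed-*ˡ : ∀ m x y → signed m (x * y) ≈ x * signed m y
  signed-*ˡ zero          x y = refl
  signed-*ˡ (suc zero)    x y = -‿distribʳ-* x y
  signed-*ˡ (suc (suc m)) x y = signed-*ˡ m x y

  signed≈sign* : ∀ m x → signed m x ≈ sign m * x
  signed≈sign* zero          x = sym (*-identityˡ x)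
  signed≈sign* (suc zero)    x = sym (-1*x≈-x x)
  signed≈sign* (suc (suc m)) x = signed≈sign* m x

  signed-suc : ∀ m x → signed (suc m) x ≈ - signed m x
  signed-suc zero          x = refl
  signed-suc (suc zero)    x = sym (-‿involutive x)
  signed-suc (suc (suc m)) x = signed-suc m x

  sign-suc : ∀ m → sign (suc m) ≈ - sign m
  sign-suc m = signed-suc m 1#

  sign-+ : ∀ a b → sign (a ℕ.+ b) ≈ sign a * sign b
  sign-+ zero          b = sym (*-identityˡ (sign b))
  sign-+ (suc zero)    b = trans (sign-suc b) (sym (-1*x≈-x (sign b)))
  sign-+ (suc (suc a)) b = sign-+ a b

  sign*sign≈1 : ∀ m → sign m * sign m ≈ 1#
  sign*sign≈1 zero          = *-identityˡ 1#
  sign*sign≈1 (suc zero)    = trans (-1*x≈-x (- 1#)) (-‿involutive 1#)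
  sign*sign≈1 (suc (suc m)) = sign*sign≈1 m

  signAt : ∀ {m n} → Fin m → Fin n → Carrier
  signAt j l = sign (toℕ j ℕ.+ toℕ l)

  signAt-suc : ∀ {m n} (j : Fin m) (l : Fin n) → signAt (suc j) (suc l) ≡ signAt j l
  signAt-suc j l = ≡.cong (sign ∘ suc) (ℕP.+-suc (toℕ j) (toℕ l))

  Matrix : ℕ → Set c
  Matrix n = Fin n → Fin n → Carrier

  minor : ∀ {n} → Matrix (suc n) → Fin (suc n) → Fin (suc n) → Matrix n
  minor M i j a b = M (punchIn i a) (punchIn j b)

  det : ∀ n → Matrix n → Carrier
  det zero    M = 1#
  det (suc n) M = sum λ j → signed (toℕ j) (M zero j * det n (minor M zero j))

  adj : ∀ n → Matrix n → Matrix n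
  adj (suc n) M i j = signed (toℕ i ℕ.+ toℕ j) (det n (minor M j i))

  sumEntries : ∀ {m n} → (Fin m → Fin n → Carrier) → Carrier
  sumEntries f = sum λ i → sum (f i)

  det-cong : ∀ n {M M′ : Matrix n} → (∀ i j → M i j ≈ M′ i j) → det n M ≈ det n M′
  det-cong zero    M≈M′ = refl
  det-cong (suc n) M≈M′ = sum-cong-≋ λ j →
    signed-cong (toℕ j) (*-cong (M≈M′ zero j) (det-cong n (λ a b → M≈M′ (punchIn zero a) (punchIn j b))))

  minor₀₁ : ∀ {n} → Matrix (suc (suc n)) → Fin (suc (suc n)) → Fin (suc n) → Matrix n
  minor₀₁ M j l a b = M (suc (suc a)) (punchIn j (punchIn l b))

  det-expand₀₁ : ∀ n (M : Matrix (suc (suc n))) → det (suc (suc n)) M ≈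
    sumEntries λ j l → signAt j l * (M zero j * (M (suc zero) (punchIn j l) * det n (minor₀₁ M j l)))
  det-expand₀₁ n M = sum-cong-≋ λ j → begin
    signed (toℕ j) (M zero j * sum (λ l → signed (toℕ l) (X j l)))
      ≈⟨ signed≈sign* (toℕ j) _ ⟩
    sign (toℕ j) * (M zero j * sum (λ l → signed (toℕ l) (X j l)))
      ≈⟨ *-assoc _ _ _ ⟨
    (sign (toℕ j) * M zero j) * sum (λ l → signed (toℕ l) (X j l))
      ≈⟨ *-distribˡ-sum (sign (toℕ j) * M zero j) (λ l → signed (toℕ l) (X j l)) ⟩
    sum (λ l → (sign (toℕ j) * M zero j) * signed (toℕ l) (X j l))
      ≈⟨ sum-cong-≋ (λ l → *-congˡ {sign (toℕ j) * M zero j} (signed≈sign* (toℕ l) (X j l))) ⟩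
    sum (λ l → (sign (toℕ j) * M zero j) * (sign (toℕ l) * X j l))
      ≈⟨ sum-cong-≋ (λ l → trans (interchange (sign (toℕ j)) (M zero j) (sign (toℕ l)) (X j l))
                                 (*-congʳ (sym (sign-+ (toℕ j) (toℕ l))))) ⟩
    sum (λ l → signAt j l * (M zero j * X j l)) ∎
    where
    X : Fin (suc (suc n)) → Fin (suc n) → Carrier
    X j l = M (suc zero) (punchIn j l) * det n (minor₀₁ M j l)

  -- The term (j , l) of the expansion along rows 0 and 1 takes columns j and punchIn j l;
  -- its partner exchange j l takes the same two columns the other way round.
  exchange : ∀ {n} → Fin (suc (suc n)) → Fin (suc n) → Fin (suc (suc n)) × Fin (suc n)
  exchange         zero    l       = suc l , zero
  exchange         (suc j) zero    = zero , j
  exchange {suc n} (suc j) (suc l) = Product.map suc suc (exchange j l)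

  exchange-fst : ∀ {n} (j : Fin (suc (suc n))) l → proj₁ (exchange j l) ≡ punchIn j l
  exchange-fst         zero    l       = ≡.refl
  exchange-fst         (suc j) zero    = ≡.refl
  exchange-fst {suc n} (suc j) (suc l) = ≡.cong suc (exchange-fst j l)

  exchange-punchIn : ∀ {n} (j : Fin (suc (suc n))) l → uncurry punchIn (exchange j l) ≡ j
  exchange-punchIn         zero    l       = ≡.refl
  exchange-punchIn         (suc j) zero    = ≡.refl
  exchange-punchIn {suc n} (suc j) (suc l) = ≡.cong suc (exchange-punchIn j l)

  exchange-punchIn² : ∀ {n} (j : Fin (suc (suc n))) l b →
    uncurry (λ j′ l′ → punchIn j′ (punchIn l′ b)) (exchange j l) ≡ punchIn j (punchIn l b)
  exchange-punchIn²         zero    l       b       = ≡.refl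
  exchange-punchIn²         (suc j) zero    b       = ≡.refl
  exchange-punchIn² {suc n} (suc j) (suc l) zero    = ≡.refl
  exchange-punchIn² {suc n} (suc j) (suc l) (suc b) = ≡.cong suc (exchange-punchIn² j l b)

  exchange-signAt : ∀ {n} (j : Fin (suc (suc n))) l → signAt j l ≈ - uncurry signAt (exchange j l)
  exchange-signAt zero l rewrite ℕP.+-identityʳ (toℕ l) =
    sym (trans (-‿cong (sign-suc (toℕ l))) (-‿involutive (sign (toℕ l))))
  exchange-signAt (suc j) zero rewrite ℕP.+-identityʳ (toℕ j) = sign-suc (toℕ j)
  exchange-signAt {suc n} (suc j) (suc l) = begin
    signAt (suc j) (suc l)                       ≡⟨ signAt-suc j l ⟩
    signAt j l                                   ≈⟨ exchange-signAt j l ⟩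
    - uncurry signAt (exchange j l)              ≡⟨ ≡.cong -_ (uncurry signAt-suc (exchange j l)) ⟨
    - uncurry signAt (exchange (suc j) (suc l))  ∎

  sumEntries-exchange : ∀ n (f : Fin (suc (suc n)) → Fin (suc n) → Carrier) →
    sumEntries (λ j l → uncurry f (exchange j l)) ≈ sumEntries f
  sumEntries-exchange zero    f = x+yz≈y+xz (f (suc zero) zero + 0#) (f zero zero + 0#) 0#
  sumEntries-exchange (suc n) f = begin
    A + sum (λ j → f zero j + sum λ l → uncurry g (exchange j l))
      ≈⟨ +-congˡ (∑-distrib-+ (f zero) (λ j → sum λ l → uncurry g (exchange j l))) ⟩
    A + (B + sumEntries (λ j l → uncurry g (exchange j l)))
      ≈⟨ +-congˡ (+-congˡ (sumEntries-exchange n g)) ⟩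
    A + (B + sumEntries g)
      ≈⟨ x+yz≈y+xz A B (sumEntries g) ⟩
    B + (A + sumEntries g)
      ≈⟨ +-congˡ (∑-distrib-+ (λ j → f (suc j) zero) (sum ∘ g)) ⟨
    sumEntries f ∎
    where
    g : Fin (suc (suc n)) → Fin (suc n) → Carrier
    g j l = f (suc j) (suc l)
    A B : Carrier
    A = sum λ l → f (suc l) zero
    B = sum λ j → f zero j

  swap₀₁ : ∀ {n} → Fin (suc (suc n)) → Fin (suc (suc n))
  swap₀₁ zero          = suc zero
  swap₀₁ (suc zero)    = zero
  swap₀₁ (suc (suc a)) = suc (suc a)

  det-swap₀₁ : ∀ n (M : Matrix (suc (suc n))) → det (suc (suc n)) (M ∘ swap₀₁) ≈ - det (suc (suc n)) M
  det-swap₀₁ n M = begin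
    det (suc (suc n)) (M ∘ swap₀₁)                    ≈⟨ det-expand₀₁ n (M ∘ swap₀₁) ⟩
    sumEntries T′                                    ≈⟨ sum-cong-≋ (λ j → sum-cong-≋ (T′-exchange j)) ⟩
    sumEntries (λ j l → - T∘exchange j l)            ≈⟨ sum-cong-≋ (λ j → sum-neg (T∘exchange j)) ⟩
    sum (λ j → - sum (T∘exchange j))                 ≈⟨ sum-neg (λ j → sum (T∘exchange j)) ⟩
    - sumEntries T∘exchange                          ≈⟨ -‿cong (sumEntries-exchange n T) ⟩
    - sumEntries T                                   ≈⟨ -‿cong (det-expand₀₁ n M) ⟨
    - det (suc (suc n)) M                            ∎
    where
    T T′ : Fin (suc (suc n)) → Fin (suc n) → Carrier
    T  j l = signAt j l * (M zero j * (M (suc zero) (punchIn j l) * det n (minor₀₁ M j l)))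
    T′ j l = signAt j l * (M (suc zero) j * (M zero (punchIn j l) * det n (minor₀₁ M j l)))
    T∘exchange : Fin (suc (suc n)) → Fin (suc n) → Carrier
    T∘exchange j l = uncurry T (exchange j l)
    T′-exchange : ∀ j l → T′ j l ≈ - T∘exchange j l
    T′-exchange j l = begin
      signAt j l * (M (suc zero) j * (M zero (punchIn j l) * det n (minor₀₁ M j l)))
        ≈⟨ *-cong (exchange-signAt j l) (x∙yz≈y∙xz _ _ _) ⟩
      - signAt j′ l′ * (M zero (punchIn j l) * (M (suc zero) j * det n (minor₀₁ M j l)))
        ≈⟨ *-congˡ (*-cong (reflexive (≡.cong (M zero) (≡.sym (exchange-fst j l))))
                   (*-cong (reflexive (≡.cong (M (suc zero)) (≡.sym (exchange-punchIn j l))))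
                     (det-cong n (λ a b → reflexive (≡.cong (M (suc (suc a)))
                                                           (≡.sym (exchange-punchIn² j l b))))))) ⟩
      - signAt j′ l′ * (M zero j′ * (M (suc zero) (punchIn j′ l′) * det n (minor₀₁ M j′ l′)))
        ≈⟨ -‿distribˡ-* _ _ ⟨
      - T∘exchange j l ∎
      where
      j′ = proj₁ (exchange j l)
      l′ = proj₂ (exchange j l)

  toFront : ∀ {n} → Fin (suc n) → Fin (suc n) → Fin (suc n)
  toFront k zero    = k
  toFront k (suc a) = punchIn k a

  toFront-suc : ∀ {n} (k : Fin (suc n)) i → toFront (suc k) i ≡ lift 1 (toFront k) (swap₀₁ i)
  toFront-suc k zero          = ≡.refl
  toFront-suc k (suc zero)    = ≡.refl
  toFront-suc k (suc (suc a)) = ≡.refl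

  det-toFront : ∀ n (k : Fin (suc n)) (M : Matrix (suc n)) →
    det (suc n) (M ∘ toFront k) ≈ sign (toℕ k) * det (suc n) M
  det-toFront n zero M = trans (det-cong (suc n) unchanged) (sym (*-identityˡ _))
    where
    unchanged : ∀ i j → M (toFront zero i) j ≈ M i j
    unchanged zero    j = refl
    unchanged (suc a) j = refl
  det-toFront (suc n) (suc k) M = begin
    det (suc (suc n)) (M ∘ toFront (suc k))
      ≈⟨ det-cong (suc (suc n)) (λ i j → reflexive (≡.cong (λ r → M r j) (toFront-suc k i))) ⟩
    det (suc (suc n)) (M ∘ lift 1 (toFront k) ∘ swap₀₁)  ≈⟨ det-swap₀₁ n (M ∘ lift 1 (toFront k)) ⟩
    - det (suc (suc n)) (M ∘ lift 1 (toFront k))         ≈⟨ -‿cong lowerRows ⟩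
    - (sign (toℕ k) * det (suc (suc n)) M)                ≈⟨ -‿distribˡ-* _ _ ⟩
    - sign (toℕ k) * det (suc (suc n)) M                  ≈⟨ *-congʳ (sign-suc (toℕ k)) ⟨
    sign (suc (toℕ k)) * det (suc (suc n)) M              ∎
    where
    lowerRows : det (suc (suc n)) (M ∘ lift 1 (toFront k)) ≈ sign (toℕ k) * det (suc (suc n)) M
    lowerRows = begin
      sum (λ j → signed (toℕ j) (M zero j * det (suc n) (minor M zero j ∘ toFront k)))
        ≈⟨ sum-cong-≋ (λ j → signed-cong (toℕ j) (*-congˡ {M zero j} (det-toFront n k (minor M zero j)))) ⟩
      sum (λ j → signed (toℕ j) (M zero j * (sign (toℕ k) * d j)))
        ≈⟨ sum-cong-≋ (λ j → trans (signed-cong (toℕ j) (x∙yz≈y∙xz (M zero j) (sign (toℕ k)) (d j)))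
                                   (signed-*ˡ (toℕ j) (sign (toℕ k)) (M zero j * d j))) ⟩
      sum (λ j → sign (toℕ k) * signed (toℕ j) (M zero j * d j))
        ≈⟨ *-distribˡ-sum (sign (toℕ k)) (λ j → signed (toℕ j) (M zero j * d j)) ⟨
      sign (toℕ k) * det (suc (suc n)) M ∎
      where
      d : Fin (suc (suc n)) → Carrier
      d j = det (suc n) (minor M zero j)

  det-laplace : ∀ n (M : Matrix (suc n)) k →
    sign (toℕ k) * det (suc n) M ≈ sum λ j → signed (toℕ j) (M k j * det n (minor M k j))
  det-laplace n M k = sym (det-toFront n k M)

  replaceRow : ∀ {n} → Matrix n → Fin n → (Fin n → Carrier) → Matrix n
  replaceRow M l v r with r ≟ l
  ... | yes _ = v
  ... | no  _ = M r

  replaceRow-≢ : ∀ {n} (M : Matrix n) {l} v {r} → r ≢ l → ∀ c → replaceRow M l v r c ≈ M r c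
  replaceRow-≢ M {l} v {r} r≢l c with r ≟ l
  ... | yes r≡l = ⊥-elim (r≢l r≡l)
  ... | no  _   = refl

  replaceRow-≡ : ∀ {n} (M : Matrix n) l v c → replaceRow M l v l c ≈ v c
  replaceRow-≡ M l v c with l ≟ l
  ... | yes _   = refl
  ... | no  l≢l = ⊥-elim (l≢l ≡.refl)

  replaceRow-self : ∀ {n} (M : Matrix n) l r c → replaceRow M l (M l) r c ≈ M r c
  replaceRow-self M l r c with r ≟ l
  ... | yes ≡.refl = refl
  ... | no  _      = refl

  sum-*-adj : ∀ n (M : Matrix (suc n)) i l →
    sum (λ j → M i j * adj (suc n) M j l) ≈ det (suc n) (replaceRow M l (M i))
  sum-*-adj n M i l = begin
    sum (λ j → M i j * signed (toℕ j ℕ.+ toℕ l) (d j))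
      ≈⟨ sum-cong-≋ moveSign ⟩
    sum (λ j → sign (toℕ l) * signed (toℕ j) (M i j * d j))
      ≈⟨ *-distribˡ-sum (sign (toℕ l)) (λ j → signed (toℕ j) (M i j * d j)) ⟨
    sign (toℕ l) * sum (λ j → signed (toℕ j) (M i j * d j))
      ≈⟨ *-congˡ (sum-cong-≋ λ j → signed-cong (toℕ j)
           (*-cong (sym (replaceRow-≡ M l (M i) j)) (det-cong n (minorN≈minorM j)))) ⟩
    sign (toℕ l) * sum (λ j → signed (toℕ j) (N l j * det n (minor N l j)))
      ≈⟨ *-congˡ (det-laplace n N l) ⟨
    sign (toℕ l) * (sign (toℕ l) * det (suc n) N)  ≈⟨ *-assoc _ _ _ ⟨
    (sign (toℕ l) * sign (toℕ l)) * det (suc n) N  ≈⟨ *-congʳ (sign*sign≈1 (toℕ l)) ⟩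
    1# * det (suc n) N                             ≈⟨ *-identityˡ _ ⟩
    det (suc n) N                                  ∎
    where
    N : Matrix (suc n)
    N = replaceRow M l (M i)
    d : Fin (suc n) → Carrier
    d j = det n (minor M l j)
    minorN≈minorM : ∀ j a b → minor M l j a b ≈ minor N l j a b
    minorN≈minorM j a b = sym (replaceRow-≢ M (M i) (punchInᵢ≢i l a) (punchIn j b))
    moveSign : ∀ j → M i j * signed (toℕ j ℕ.+ toℕ l) (d j) ≈ sign (toℕ l) * signed (toℕ j) (M i j * d j)
    moveSign j = begin
      M i j * signed (toℕ j ℕ.+ toℕ l) (d j)         ≈⟨ signed-*ˡ (toℕ j ℕ.+ toℕ l) (M i j) (d j) ⟨
      signed (toℕ j ℕ.+ toℕ l) (M i j * d j)         ≈⟨ signed≈sign* (toℕ j ℕ.+ toℕ l) _ ⟩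
      sign (toℕ j ℕ.+ toℕ l) * (M i j * d j)         ≈⟨ *-congʳ (sign-+ (toℕ j) (toℕ l)) ⟩
      (sign (toℕ j) * sign (toℕ l)) * (M i j * d j)  ≈⟨ xy∙z≈y∙xz _ _ _ ⟩
      sign (toℕ l) * (sign (toℕ j) * (M i j * d j))  ≈⟨ *-congˡ (signed≈sign* (toℕ j) _) ⟨
      sign (toℕ l) * signed (toℕ j) (M i j * d j)    ∎

  EqualRowsVanish : ℕ → Set (c ⊔ ℓ)
  EqualRowsVanish n = ∀ (M : Matrix n) {i k} → i ≢ k → (∀ c → M i c ≈ M k c) → det n M ≈ 0#

  det-equalRows-lower : ∀ n → EqualRowsVanish n → ∀ (M : Matrix (suc n)) {i k} →
    i ≢ k → (∀ c → M (suc i) c ≈ M (suc k) c) → det (suc n) M ≈ 0#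
  det-equalRows-lower n vanish M i≢k rows≈ = sum-zero λ j → begin
    signed (toℕ j) (M zero j * det n (minor M zero j))
      ≈⟨ signed≈sign* (toℕ j) _ ⟩
    sign (toℕ j) * (M zero j * det n (minor M zero j))
      ≈⟨ *-congˡ (*-congˡ (vanish (minor M zero j) i≢k (rows≈ ∘ punchIn j))) ⟩
    sign (toℕ j) * (M zero j * 0#)  ≈⟨ *-congˡ (zeroʳ (M zero j)) ⟩
    sign (toℕ j) * 0#               ≈⟨ zeroʳ (sign (toℕ j)) ⟩
    0#                              ∎

  module _ (noTwoTorsion : ∀ x → x + x ≈ 0# → x ≈ 0#) where

    det-equalRows-first : ∀ n → EqualRowsVanish n → ∀ (M : Matrix (suc n)) k →
      (∀ c → M zero c ≈ M (suc k) c) → det (suc n) M ≈ 0#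
    det-equalRows-first (suc n) vanish M zero rows≈ =
      noTwoTorsion _ (trans (+-congˡ (trans (det-cong (suc (suc n)) unchanged) (det-swap₀₁ n M))) (-‿inverseʳ _))
      where
      unchanged : ∀ i c → M i c ≈ M (swap₀₁ i) c
      unchanged zero          c = rows≈ c
      unchanged (suc zero)    c = sym (rows≈ c)
      unchanged (suc (suc a)) c = refl
    det-equalRows-first (suc n) vanish M (suc k) rows≈ = -‿injective (begin
      - det (suc (suc n)) M           ≈⟨ det-swap₀₁ n M ⟨
      det (suc (suc n)) (M ∘ swap₀₁)
        ≈⟨ det-equalRows-lower (suc n) vanish (M ∘ swap₀₁) {zero} {suc k} (λ ()) rows≈ ⟩
      0#                              ≈⟨ -0#≈0# ⟨
      - 0#                            ∎)

    det-equalRows : ∀ n → EqualRowsVanish n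
    det-equalRows (suc n) M {zero}  {zero}  i≢k _     = ⊥-elim (i≢k ≡.refl)
    det-equalRows (suc n) M {zero}  {suc k} _   rows≈ = det-equalRows-first n (det-equalRows n) M k rows≈
    det-equalRows (suc n) M {suc i} {zero}  _   rows≈ = det-equalRows-first n (det-equalRows n) M i (sym ∘ rows≈)
    det-equalRows (suc n) M {suc i} {suc k} i≢k rows≈ =
      det-equalRows-lower n (det-equalRows n) M (i≢k ∘ ≡.cong suc) rows≈

    sum-*-adj-≢ : ∀ n (M : Matrix (suc n)) {i l} → i ≢ l → sum (λ j → M i j * adj (suc n) M j l) ≈ 0#
    sum-*-adj-≢ n M {i} {l} i≢l = trans (sum-*-adj n M i l)
      (det-equalRows (suc n) (replaceRow M l (M i)) i≢l
        (λ c → trans (replaceRow-≢ M (M i) i≢l c) (sym (replaceRow-≡ M l (M i) c))))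

    sum-*-adj-≡ : ∀ n (M : Matrix (suc n)) l → sum (λ j → M l j * adj (suc n) M j l) ≈ det (suc n) M
    sum-*-adj-≡ n M l = trans (sum-*-adj n M l l) (det-cong (suc n) (replaceRow-self M l))

    sum*det≈sumEntries-adj : ∀ n (M : Matrix n) (e : Fin n → Carrier) →
      (∀ z → sum (λ y → e y * M y z) ≈ 1#) → sum e * det n M ≈ sumEntries (adj n M)
    sum*det≈sumEntries-adj zero    M e eM≈1 = zeroˡ 1#
    sum*det≈sumEntries-adj (suc n) M e eM≈1 = sym (begin
      sumEntries A
        ≈⟨ sum-cong-≋ (λ i → sum-cong-≋ λ j → trans (sym (*-identityˡ (A i j))) (*-congʳ (sym (eM≈1 i)))) ⟩
      sumEntries (λ i j → sum (λ y → e y * M y i) * A i j)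
        ≈⟨ sum-cong-≋ (λ i → sum-cong-≋ λ j → trans (*-distribʳ-sum (A i j) (λ y → e y * M y i))
                                                  (sum-cong-≋ λ y → *-assoc (e y) (M y i) (A i j))) ⟩
      sum (λ i → sum λ j → sum λ y → e y * (M y i * A i j))
        ≈⟨ ∑-comm (λ i j → sum λ y → e y * (M y i * A i j)) ⟩
      sum (λ j → sum λ i → sum λ y → e y * (M y i * A i j))
        ≈⟨ sum-cong-≋ (λ j → ∑-comm (λ i y → e y * (M y i * A i j))) ⟩
      sum (λ j → sum λ y → sum λ i → e y * (M y i * A i j))
        ≈⟨ sum-cong-≋ (λ j → sum-cong-≋ (λ y → *-distribˡ-sum (e y) (λ i → M y i * A i j))) ⟨
      sum (λ j → sum λ y → e y * sum (λ i → M y i * A i j))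
        ≈⟨ sum-cong-≋ (λ j → sum-single _ j λ y y≢j → trans (*-congˡ (sum-*-adj-≢ n M y≢j)) (zeroʳ (e y))) ⟩
      sum (λ j → e j * sum (λ i → M j i * A i j))
        ≈⟨ sum-cong-≋ (λ j → *-congˡ {e j} (sum-*-adj-≡ n M j)) ⟩
      sum (λ j → e j * det (suc n) M)
        ≈⟨ *-distribʳ-sum (det (suc n) M) e ⟨
      sum e * det (suc n) M ∎)
      where
      A : Matrix (suc n)
      A = adj (suc n) M

-- The ring of formal power series ℤ[[s]]

open import Defs
open import Data.Integer as ℤ using (ℤ; +_; -[1+_])
import Data.Integer.Properties as ℤP
open import Data.Integer.Tactic.RingSolver using (solve-∀)
open import Algebra.Properties.CommutativeSemigroup ℤP.+-commutativeSemigroup using (interchange)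
open import Algebra.Definitions.RawMonoid ℕ.+-0-rawMonoid using () renaming (sum to sumℕ)
open ≡ using (refl; sym; trans; cong; cong₂; module ≡-Reasoning)

sumTo-cong≤ : ∀ n {f g : ℕ → ℤ} → (∀ j → j ℕ.≤ n → f j ≡ g j) → sumTo n f ≡ sumTo n g
sumTo-cong≤ zero    f≡g = f≡g 0 ℕ.z≤n
sumTo-cong≤ (suc n) f≡g =
  cong₂ ℤ._+_ (sumTo-cong≤ n (λ j j≤n → f≡g j (ℕP.m≤n⇒m≤1+n j≤n))) (f≡g (suc n) ℕP.≤-refl)

sumTo-cong : ∀ n {f g : ℕ → ℤ} → (∀ j → f j ≡ g j) → sumTo n f ≡ sumTo n g
sumTo-cong n f≡g = sumTo-cong≤ n (λ j _ → f≡g j)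

sumTo-suc : ∀ n (f : ℕ → ℤ) → sumTo (suc n) f ≡ f 0 ℤ.+ sumTo n (f ∘ suc)
sumTo-suc zero    f = refl
sumTo-suc (suc n) f = trans (cong (ℤ._+ f (suc (suc n))) (sumTo-suc n f))
                            (ℤP.+-assoc (f 0) (sumTo n (f ∘ suc)) (f (suc (suc n))))

sumTo-+ : ∀ n (f g : ℕ → ℤ) → sumTo n (λ j → f j ℤ.+ g j) ≡ sumTo n f ℤ.+ sumTo n g
sumTo-+ zero    f g = refl
sumTo-+ (suc n) f g = trans (cong (ℤ._+ (f (suc n) ℤ.+ g (suc n))) (sumTo-+ n f g))
                            (interchange (sumTo n f) (sumTo n g) (f (suc n)) (g (suc n)))

sumTo-*ˡ : ∀ n (c : ℤ) (f : ℕ → ℤ) → sumTo n (λ j → c ℤ.* f j) ≡ c ℤ.* sumTo n f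
sumTo-*ˡ zero    c f = refl
sumTo-*ˡ (suc n) c f = trans (cong (ℤ._+ (c ℤ.* f (suc n))) (sumTo-*ˡ n c f))
                             (sym (ℤP.*-distribˡ-+ c (sumTo n f) (f (suc n))))

sumTo-zero : ∀ n → sumTo n (λ _ → + 0) ≡ + 0
sumTo-zero zero    = refl
sumTo-zero (suc n) = cong (ℤ._+ + 0) (sumTo-zero n)

sumTo-reverse : ∀ n (f : ℕ → ℤ) → sumTo n f ≡ sumTo n (λ j → f (n ℕ.∸ j))
sumTo-reverse zero    f = refl
sumTo-reverse (suc n) f = begin
  sumTo (suc n) f                            ≡⟨ sumTo-suc n f ⟩
  f 0 ℤ.+ sumTo n (f ∘ suc)                  ≡⟨ cong (λ x → f 0 ℤ.+ x) (sumTo-reverse n (f ∘ suc)) ⟩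
  f 0 ℤ.+ sumTo n (λ j → f (suc (n ℕ.∸ j)))  ≡⟨ ℤP.+-comm (f 0) _ ⟩
  sumTo n (λ j → f (suc (n ℕ.∸ j))) ℤ.+ f 0
    ≡⟨ cong₂ ℤ._+_ (sumTo-cong≤ n (λ j j≤n → cong f (sym (ℕP.+-∸-assoc 1 j≤n))))
                   (cong f (sym (ℕP.n∸n≡0 n))) ⟩
  sumTo (suc n) (λ j → f (suc n ℕ.∸ j))      ∎
  where open ≡-Reasoning

_≈ₛ_ : Series → Series → Set
f ≈ₛ g = ∀ n → f n ≡ g n

_·ₛ_ : ℤ → Series → Series
(c ·ₛ f) n = c ℤ.* f n

*ₛ-suc : ∀ n f g → (f *ₛ g) (suc n) ≡ f 0 ℤ.* g (suc n) ℤ.+ ((f ∘ suc) *ₛ g) n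
*ₛ-suc n f g = sumTo-suc n _

*ₛ-cong : ∀ {f f′ g g′} → f ≈ₛ f′ → g ≈ₛ g′ → (f *ₛ g) ≈ₛ (f′ *ₛ g′)
*ₛ-cong f≈f′ g≈g′ n = sumTo-cong n (λ j → cong₂ ℤ._*_ (f≈f′ j) (g≈g′ (n ℕ.∸ j)))

*ₛ-comm : ∀ f g → (f *ₛ g) ≈ₛ (g *ₛ f)
*ₛ-comm f g n = trans (sumTo-reverse n _) (sumTo-cong≤ n λ j j≤n →
  trans (cong (λ i → f (n ℕ.∸ j) ℤ.* g i) (ℕP.m∸[m∸n]≡n j≤n)) (ℤP.*-comm (f (n ℕ.∸ j)) (g j)))

*ₛ-identityˡ : ∀ f → (1ₛ *ₛ f) ≈ₛ f
*ₛ-identityˡ f zero    = ℤP.*-identityˡ (f 0)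
*ₛ-identityˡ f (suc n) = begin
  (1ₛ *ₛ f) (suc n)                                        ≡⟨ *ₛ-suc n 1ₛ f ⟩
  + 1 ℤ.* f (suc n) ℤ.+ sumTo n (λ j → + 0 ℤ.* f (n ℕ.∸ j))
    ≡⟨ cong₂ ℤ._+_ (ℤP.*-identityˡ (f (suc n))) (sumTo-zero n) ⟩
  f (suc n) ℤ.+ + 0                                        ≡⟨ ℤP.+-identityʳ _ ⟩
  f (suc n)                                                ∎
  where open ≡-Reasoning

*ₛ-identityʳ : ∀ f → (f *ₛ 1ₛ) ≈ₛ f
*ₛ-identityʳ f n = trans (*ₛ-comm f 1ₛ n) (*ₛ-identityˡ f n)

*ₛ-distribˡ : ∀ f g h → (f *ₛ (g +ₛ h)) ≈ₛ ((f *ₛ g) +ₛ (f *ₛ h))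
*ₛ-distribˡ f g h n =
  trans (sumTo-cong n (λ j → ℤP.*-distribˡ-+ (f j) (g (n ℕ.∸ j)) (h (n ℕ.∸ j)))) (sumTo-+ n _ _)

*ₛ-distribʳ : ∀ f g h → ((g +ₛ h) *ₛ f) ≈ₛ ((g *ₛ f) +ₛ (h *ₛ f))
*ₛ-distribʳ f g h n = begin
  ((g +ₛ h) *ₛ f) n          ≡⟨ *ₛ-comm (g +ₛ h) f n ⟩
  (f *ₛ (g +ₛ h)) n          ≡⟨ *ₛ-distribˡ f g h n ⟩
  (f *ₛ g) n ℤ.+ (f *ₛ h) n  ≡⟨ cong₂ ℤ._+_ (*ₛ-comm f g n) (*ₛ-comm f h n) ⟩
  (g *ₛ f) n ℤ.+ (h *ₛ f) n  ∎
  where open ≡-Reasoning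

·ₛ-*ₛ : ∀ c f g → ((c ·ₛ f) *ₛ g) ≈ₛ (c ·ₛ (f *ₛ g))
·ₛ-*ₛ c f g n = trans (sumTo-cong n (λ j → ℤP.*-assoc c (f j) (g (n ℕ.∸ j)))) (sumTo-*ˡ n c _)

*ₛ-assoc : ∀ f g h → ((f *ₛ g) *ₛ h) ≈ₛ (f *ₛ (g *ₛ h))
*ₛ-assoc f g h zero    = ℤP.*-assoc (f 0) (g 0) (h 0)
*ₛ-assoc f g h (suc m) = begin
  ((f *ₛ g) *ₛ h) (suc m)                                           ≡⟨ *ₛ-suc m (f *ₛ g) h ⟩
  f 0 ℤ.* g 0 ℤ.* h (suc m) ℤ.+ (((f *ₛ g) ∘ suc) *ₛ h) m
    ≡⟨ cong (λ x → f 0 ℤ.* g 0 ℤ.* h (suc m) ℤ.+ x) tail-step ⟩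
  f 0 ℤ.* g 0 ℤ.* h (suc m) ℤ.+ (f 0 ℤ.* ((g ∘ suc) *ₛ h) m ℤ.+ ((f ∘ suc) *ₛ (g *ₛ h)) m)
    ≡⟨ regroup (f 0) (g 0) (h (suc m)) (((g ∘ suc) *ₛ h) m) (((f ∘ suc) *ₛ (g *ₛ h)) m) ⟩
  f 0 ℤ.* (g 0 ℤ.* h (suc m) ℤ.+ ((g ∘ suc) *ₛ h) m) ℤ.+ ((f ∘ suc) *ₛ (g *ₛ h)) m
    ≡⟨ cong (λ x → f 0 ℤ.* x ℤ.+ ((f ∘ suc) *ₛ (g *ₛ h)) m) (*ₛ-suc m g h) ⟨
  f 0 ℤ.* (g *ₛ h) (suc m) ℤ.+ ((f ∘ suc) *ₛ (g *ₛ h)) m           ≡⟨ *ₛ-suc m f (g *ₛ h) ⟨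
  (f *ₛ (g *ₛ h)) (suc m)                                           ∎
  where
  open ≡-Reasoning
  regroup : ∀ a b c d e → a ℤ.* b ℤ.* c ℤ.+ (a ℤ.* d ℤ.+ e) ≡ a ℤ.* (b ℤ.* c ℤ.+ d) ℤ.+ e
  regroup = solve-∀
  tail-step : (((f *ₛ g) ∘ suc) *ₛ h) m ≡ f 0 ℤ.* ((g ∘ suc) *ₛ h) m ℤ.+ ((f ∘ suc) *ₛ (g *ₛ h)) m
  tail-step = begin
    (((f *ₛ g) ∘ suc) *ₛ h) m
      ≡⟨ *ₛ-cong {g = h} (λ k → *ₛ-suc k f g) (λ _ → refl) m ⟩
    (((f 0 ·ₛ (g ∘ suc)) +ₛ ((f ∘ suc) *ₛ g)) *ₛ h) m
      ≡⟨ *ₛ-distribʳ h (f 0 ·ₛ (g ∘ suc)) ((f ∘ suc) *ₛ g) m ⟩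
    ((f 0 ·ₛ (g ∘ suc)) *ₛ h) m ℤ.+ (((f ∘ suc) *ₛ g) *ₛ h) m
      ≡⟨ cong₂ ℤ._+_ (·ₛ-*ₛ (f 0) (g ∘ suc) h m) (*ₛ-assoc (f ∘ suc) g h m) ⟩
    f 0 ℤ.* ((g ∘ suc) *ₛ h) m ℤ.+ ((f ∘ suc) *ₛ (g *ₛ h)) m ∎

seriesRing : CommutativeRing _ _
seriesRing = record
  { Carrier = Series ; _≈_ = _≈ₛ_ ; _+_ = _+ₛ_ ; _*_ = _*ₛ_ ; -_ = -ₛ_ ; 0# = 0ₛ ; 1# = 1ₛ
  ; isCommutativeRing = record
    { isRing = record
      { +-isAbelianGroup = record
        { isGroup = record
          { isMonoid = record
            { isSemigroup = record
              { isMagma = record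
                { isEquivalence = record
                  { refl = λ _ → refl ; sym = λ f≈g n → sym (f≈g n) ; trans = λ f≈g g≈h n → trans (f≈g n) (g≈h n) }
                ; ∙-cong = λ f≈f′ g≈g′ n → cong₂ ℤ._+_ (f≈f′ n) (g≈g′ n) }
              ; assoc = λ f g h n → ℤP.+-assoc (f n) (g n) (h n) }
            ; identity = (λ f n → ℤP.+-identityˡ (f n)) , (λ f n → ℤP.+-identityʳ (f n)) }
          ; inverse = (λ f n → ℤP.+-inverseˡ (f n)) , (λ f n → ℤP.+-inverseʳ (f n))
          ; ⁻¹-cong = λ f≈g n → cong ℤ.-_ (f≈g n) }
        ; comm = λ f g n → ℤP.+-comm (f n) (g n) }
      ; *-cong = *ₛ-cong
      ; *-assoc = *ₛ-assoc
      ; *-identity = *ₛ-identityˡ , *ₛ-identityʳ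
      ; distrib = *ₛ-distribˡ , *ₛ-distribʳ }
    ; *-comm = *ₛ-comm } }

series-noTwoTorsion : ∀ f → (f +ₛ f) ≈ₛ 0ₛ → f ≈ₛ 0ₛ
series-noTwoTorsion f f+f≈0 n = noTwoTorsion (f n) (f+f≈0 n)
  where
  noTwoTorsion : ∀ x → x ℤ.+ x ≡ + 0 → x ≡ + 0
  noTwoTorsion (+ zero)  _ = refl
  noTwoTorsion (+ suc m) ()
  noTwoTorsion -[1+ m ]  ()

-- Counting chains

Σ-Fin-suc↔ : ∀ {n} (F : Fin (suc n) → Set) → Σ (Fin (suc n)) F ↔ (F zero ⊎ Σ (Fin n) (F ∘ suc))
Σ-Fin-suc↔ F = mk↔ₛ′ to from to∘from from∘to
  where
  to : Σ (Fin _) F → F zero ⊎ Σ (Fin _) (F ∘ suc)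
  to (zero  , x) = inj₁ x
  to (suc i , x) = inj₂ (i , x)
  from : F zero ⊎ Σ (Fin _) (F ∘ suc) → Σ (Fin _) F
  from (inj₁ x)       = zero , x
  from (inj₂ (i , x)) = suc i , x
  to∘from : ∀ p → to (from p) ≡ p
  to∘from (inj₁ x) = refl
  to∘from (inj₂ _) = refl
  from∘to : ∀ p → from (to p) ≡ p
  from∘to (zero  , x) = refl
  from∘to (suc i , x) = refl

Σ-Fin↔ : ∀ {n} {F : Fin n → Set} (size : Fin n → ℕ) → (∀ i → F i ↔ Fin (size i)) →
  Σ (Fin n) F ↔ Fin (sumℕ size)
Σ-Fin↔ {zero}          size F↔ = mk↔ₛ′ (λ { (() , _) }) (λ ()) (λ ()) (λ { (() , _) })
Σ-Fin↔ {suc n} {F = F} size F↔ =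
  ↔-sym +↔⊎ ↔-∘ ((F↔ zero ⊎-↔ Σ-Fin↔ (size ∘ suc) (F↔ ∘ suc)) ↔-∘ Σ-Fin-suc↔ F)

module _ (C : FinCat) where
  open FinCat C

  chainCount : ℕ → Fin k → ℕ
  chainCount zero    y = 1
  chainCount (suc i) z = sumℕ λ y → chainCount i y ℕ.* hom y z

  Chain-suc↔ : ∀ i z → Chain C (suc i) z ↔ Σ (Fin k) (λ y → Chain C i y × Hom y z)
  Chain-suc↔ i z = mk↔ₛ′ to from (λ _ → refl) from∘to
    where
    to : Chain C (suc i) z → Σ (Fin k) (λ y → Chain C i y × Hom y z)
    to (step γ f) = _ , γ , f
    from : Σ (Fin k) (λ y → Chain C i y × Hom y z) → Chain C (suc i) z
    from (y , γ , f) = step γ f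
    from∘to : ∀ γ → from (to γ) ≡ γ
    from∘to (step γ f) = refl

  Chain↔ : ∀ i y → Chain C i y ↔ Fin (chainCount i y)
  Chain↔ zero    y = mk↔ₛ′ (λ _ → zero) (λ _ → start y) (λ { zero → refl }) (λ { (start .y) → refl })
  Chain↔ (suc i) z = Σ-Fin↔ _ (λ y → ↔-sym *↔× ↔-∘ (Chain↔ i y ×-↔ ↔-id (Hom y z))) ↔-∘ Chain-suc↔ i z

  N↔ : ∀ i → N C i ↔ Fin (sumℕ (chainCount i))
  N↔ i = Σ-Fin↔ (chainCount i) (Chain↔ i)

-- The zeta series

module ℤΣ = RingSum ℤP.+-*-ring
module D = Determinant seriesRing

sumFin≈sum : ∀ n (F : Fin n → Series) → sumFin n F ≈ₛ D.sum F
sumFin≈sum zero    F t = refl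
sumFin≈sum (suc n) F t = cong (λ x → F zero t ℤ.+ x) (sumFin≈sum n (F ∘ suc) t)

signₛ≈signed : ∀ m {f g} → f ≈ₛ g → signₛ m f ≈ₛ D.signed m g
signₛ≈signed zero          f≈g   = f≈g
signₛ≈signed (suc zero)    f≈g t = cong ℤ.-_ (f≈g t)
signₛ≈signed (suc (suc m)) f≈g   = signₛ≈signed m f≈g

det≈det : ∀ n (M : Matrix n) → det n M ≈ₛ D.det n M
det≈det zero    M t = refl
det≈det (suc n) M t =
  trans (sumFin≈sum (suc n) (λ j → signₛ (toℕ j) (M zero j *ₛ det n (minor M zero j))) t)
        (D.sum-cong-≋ (λ j → signₛ≈signed (toℕ j) (*ₛ-cong {M zero j} (λ _ → refl) (det≈det n (minor M zero j)))) t)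

adj≈adj : ∀ n (M : Matrix n) i j → adj n M i j ≈ₛ D.adj n M i j
adj≈adj (suc n) M i j = signₛ≈signed (toℕ i ℕ.+ toℕ j) (det≈det n (minor M j i))

sumEntries≈sumEntries : ∀ n (M : Matrix n) → sumEntries n (adj n M) ≈ₛ D.sumEntries (D.adj n M)
sumEntries≈sumEntries n M t =
  trans (sumFin≈sum n (λ i → sumFin n (adj n M i)) t)
        (D.sum-cong-≋ (λ i t′ → trans (sumFin≈sum n (adj n M i) t′) (D.sum-cong-≋ (adj≈adj n M i) t′)) t)

coeff-sum : ∀ {n} (F : Fin n → Series) t → D.sum F t ≡ ℤΣ.sum (λ y → F y t)
coeff-sum {zero}  F t = refl
coeff-sum {suc n} F t = cong (λ x → F zero t ℤ.+ x) (coeff-sum (F ∘ suc) t)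

pos-sumℕ : ∀ {n} (f : Fin n → ℕ) → + sumℕ f ≡ ℤΣ.sum (λ y → + f y)
pos-sumℕ {zero}  f = refl
pos-sumℕ {suc n} f =
  trans (ℤP.pos-+ (f zero) (sumℕ (f ∘ suc))) (cong (λ x → + f zero ℤ.+ x) (pos-sumℕ (f ∘ suc)))

*ₛ-degree≤1 : ∀ f g → (∀ t → g (suc (suc t)) ≡ + 0) → ∀ m →
  (f *ₛ g) (suc m) ≡ f m ℤ.* g 1 ℤ.+ f (suc m) ℤ.* g 0
*ₛ-degree≤1 f g g-vanishes m = cong₂ ℤ._+_ (lowerTerms m) (cong (λ i → f (suc m) ℤ.* g i) (ℕP.n∸n≡0 m))
  where
  lowerTerms : ∀ m → sumTo m (λ j → f j ℤ.* g (suc m ℕ.∸ j)) ≡ f m ℤ.* g 1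
  lowerTerms zero     = refl
  lowerTerms (suc m) = begin
    sumTo m (λ j → f j ℤ.* g (suc (suc m) ℕ.∸ j)) ℤ.+ f (suc m) ℤ.* g (suc m ℕ.∸ m)
      ≡⟨ cong₂ ℤ._+_ (sumTo-cong≤ m (λ j j≤m → trans (cong (λ i → f j ℤ.* g i) (ℕP.+-∸-assoc 2 j≤m))
                                       (trans (cong (f j ℤ.*_) (g-vanishes (m ℕ.∸ j))) (ℤP.*-zeroʳ (f j)))))
                     (cong (λ i → f (suc m) ℤ.* g i) (ℕP.m+n∸n≡m 1 m)) ⟩
    sumTo m (λ _ → + 0) ℤ.+ f (suc m) ℤ.* g 1  ≡⟨ cong (ℤ._+ f (suc m) ℤ.* g 1) (sumTo-zero m) ⟩
    + 0 ℤ.+ f (suc m) ℤ.* g 1                  ≡⟨ ℤP.+-identityˡ _ ⟩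
    f (suc m) ℤ.* g 1                          ∎
    where open ≡-Reasoning

I-As-diag : ∀ n A (y : Fin n) → I-As n A y y 0 ≡ + 1
I-As-diag n A y with y ≟ y
... | yes _   = refl
... | no  y≢y = ⊥-elim (y≢y refl)

I-As-offDiag : ∀ n A {y z : Fin n} → y ≢ z → I-As n A y z 0 ≡ + 0
I-As-offDiag n A {y} {z} y≢z with y ≟ z
... | yes y≡z = ⊥-elim (y≢z y≡z)
... | no  _   = refl

sum-*-I-As₀ : ∀ n A (f : Fin n → ℤ) z → ℤΣ.sum (λ y → f y ℤ.* I-As n A y z 0) ≡ f z
sum-*-I-As₀ n A f z = begin
  ℤΣ.sum (λ y → f y ℤ.* I-As n A y z 0)
    ≡⟨ ℤΣ.sum-single _ z (λ y y≢z → trans (cong (f y ℤ.*_) (I-As-offDiag n A y≢z)) (ℤP.*-zeroʳ (f y))) ⟩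
  f z ℤ.* I-As n A z z 0  ≡⟨ cong (f z ℤ.*_) (I-As-diag n A z) ⟩
  f z ℤ.* + 1             ≡⟨ ℤP.*-identityʳ (f z) ⟩
  f z                     ∎
  where open ≡-Reasoning

module _ (C : FinCat) where
  open FinCat C

  chainSeries : Fin k → Series
  chainSeries y = fromCoeffs λ i → chainCount C i y

  -- The coefficient of s^(m+1) counts the chains of length m+1 ending at z, minus the same
  -- chains seen as a chain of length m extended by a last morphism.
  chainSeries-*-I-As : ∀ z → D.sum (λ y → chainSeries y *ₛ I-As k hom y z) ≈ₛ 1ₛ
  chainSeries-*-I-As z zero    =
    trans (coeff-sum (λ y → chainSeries y *ₛ I-As k hom y z) 0) (sum-*-I-As₀ k hom (λ _ → + 1) z)
  chainSeries-*-I-As z (suc m) = begin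
    D.sum (λ y → chainSeries y *ₛ I-As k hom y z) (suc m)
      ≡⟨ coeff-sum (λ y → chainSeries y *ₛ I-As k hom y z) (suc m) ⟩
    ℤΣ.sum (λ y → (chainSeries y *ₛ I-As k hom y z) (suc m))
      ≡⟨ ℤΣ.sum-cong-≋ (λ y → *ₛ-degree≤1 (chainSeries y) (I-As k hom y z) (λ _ → refl) m) ⟩
    ℤΣ.sum (λ y → c m y ℤ.* ℤ.- (+ hom y z) ℤ.+ c (suc m) y ℤ.* I-As k hom y z 0)
      ≡⟨ ℤΣ.∑-distrib-+ (λ y → c m y ℤ.* ℤ.- (+ hom y z)) (λ y → c (suc m) y ℤ.* I-As k hom y z 0) ⟩
    ℤΣ.sum (λ y → c m y ℤ.* ℤ.- (+ hom y z)) ℤ.+ ℤΣ.sum (λ y → c (suc m) y ℤ.* I-As k hom y z 0)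
      ≡⟨ cong₂ ℤ._+_ extensions (sum-*-I-As₀ k hom (c (suc m)) z) ⟩
    ℤ.- c (suc m) z ℤ.+ c (suc m) z
      ≡⟨ ℤP.+-inverseˡ (c (suc m) z) ⟩
    + 0 ∎
    where
    open ≡-Reasoning
    c : ℕ → Fin k → ℤ
    c i y = + chainCount C i y
    extensions : ℤΣ.sum (λ y → c m y ℤ.* ℤ.- (+ hom y z)) ≡ ℤ.- c (suc m) z
    extensions = begin
      ℤΣ.sum (λ y → c m y ℤ.* ℤ.- (+ hom y z))
        ≡⟨ ℤΣ.sum-cong-≋ (λ y → trans (sym (ℤP.neg-distribʳ-* (c m y) (+ hom y z)))
                                        (cong ℤ.-_ (sym (ℤP.pos-* (chainCount C m y) (hom y z))))) ⟩
      ℤΣ.sum (λ y → ℤ.- (+ (chainCount C m y ℕ.* hom y z)))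
        ≡⟨ ℤΣ.sum-neg (λ y → + (chainCount C m y ℕ.* hom y z)) ⟩
      ℤ.- ℤΣ.sum (λ y → + (chainCount C m y ℕ.* hom y z))
        ≡⟨ cong ℤ.-_ (pos-sumℕ (λ y → chainCount C m y ℕ.* hom y z)) ⟨
      ℤ.- c (suc m) z ∎

  zeta≈sum-chainSeries : (c : ℕ → ℕ) → (∀ i → N C i ↔ Fin (c i)) → fromCoeffs c ≈ₛ D.sum chainSeries
  zeta≈sum-chainSeries c N↔Fin i = begin
    + c i                               ≡⟨ cong +_ (↔⇒≡ (N↔ C i ↔-∘ ↔-sym (N↔Fin i))) ⟩
    + sumℕ (chainCount C i)             ≡⟨ pos-sumℕ (chainCount C i) ⟩
    ℤΣ.sum (λ y → chainSeries y i)      ≡⟨ coeff-sum chainSeries i ⟨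
    D.sum chainSeries i                 ∎
    where open ≡-Reasoning

lemma2p1 : (C : FinCat) (c : ℕ → ℕ) →
    (∀ i → N C i ↔ Fin (c i)) →
    ∀ n → (fromCoeffs c *ₛ det (FinCat.k C) (I-As (FinCat.k C) (adjacency C))) n
          ≡ sumEntries (FinCat.k C) (adj (FinCat.k C) (I-As (FinCat.k C) (adjacency C))) n
lemma2p1 C c N↔Fin n = begin
  (fromCoeffs c *ₛ det k M) n
    ≡⟨ *ₛ-cong (zeta≈sum-chainSeries C c N↔Fin) (det≈det k M) n ⟩
  (D.sum (chainSeries C) *ₛ D.det k M) n
    ≡⟨ D.sum*det≈sumEntries-adj series-noTwoTorsion k M (chainSeries C) (chainSeries-*-I-As C) n ⟩
  D.sumEntries (D.adj k M) n
    ≡⟨ sumEntries≈sumEntries k M n ⟨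
  sumEntries k (adj k M) n ∎
  where
  open FinCat C using (k)
  open ≡-Reasoning
  M : Matrix k
  M = I-As k (adjacency C)
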